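{- Let $A=\mathbb{F}_3[T]$, let $\mathfrak{p}=(T+i)$ with $i\in\{0,\pm1\}$, let $A_{\mathfrak{p}}$ be the completion of $A$ at $\mathfrak{p}$ with uniformizer $\pi$, and let $H$ be a closed subgroup of $\mathrm{GL}_2(A_{\mathfrak{p}})$. Suppose that $\det(H)=A_{\mathfrak{p}}^*$, that $H^{[0]}=\mathrm{GL}_2(\mathbb{F}_3)$, and that $H^{[1]}$ contains a non-scalar matrix. Then $H=\mathrm{GL}_2(A_{\mathfrak{p}})$.
   Context: Set $G^0=\mathrm{GL}_2(A_{\mathfrak{p}})$ and $G^n=1+\pi^nM_2(A_{\mathfrak{p}})$ for $n\geq1$. For a subgroup $H$ put $H^n=H\cap G^n$ and $H^{[n]}=H^n/H^{n+1}$. Via the isomorphisms $G^0/G^1\cong\mathrm{GL}_2(\mathbb{F}_3)$ (reduction mod $\mathfrak{p}$) and $G^n/G^{n+1}\cong M_2(\mathbb{F}_3)$, $[1+\pi^ny]\mapsto[y \bmod \mathfrak{p}]$ for $n\ge1$, one regards $H^{[0]}$ as a subgroup of $\mathrm{GL}_2(\mathbb{F}_3)$ and $H^{[n]}$ ($n\geq1$) as an additive subgroup of $M_2(\mathbb{F}_3)$. -}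

module Defs where

open import Data.Nat using (ℕ; zero; suc; _∸_; _<_)
open import Data.Fin using (Fin; zero; suc)
open import Data.Product using (Σ; _×_; ∃; _,_)
open import Relation.Binary.PropositionalEquality using (_≡_)
open import Relation.Nullary using (¬_)

-- The field F₃ = Fin 3 (elements 0, 1, 2 = -1)

F₃ : Set
F₃ = Fin 3

0F 1F 2F : F₃
0F = zero
1F = suc zero
2F = suc (suc zero)

infixl 6 _+F_ _-F_
infixl 7 _*F_

negF : F₃ → F₃
negF zero = zero
negF (suc zero) = suc (suc zero)
negF (suc (suc zero)) = suc zero

succF : F₃ → F₃
succF zero = suc zero
succF (suc zero) = suc (suc zero)
succF (suc (suc zero)) = zero

_+F_ : F₃ → F₃ → F₃
zero +F y = y
suc zero +F y = succF y
suc (suc zero) +F y = succF (succF y)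

_-F_ : F₃ → F₃ → F₃
x -F y = x +F negF y

_*F_ : F₃ → F₃ → F₃
zero *F y = zero
suc zero *F y = y
suc (suc zero) *F y = negF y

-- A_𝔭 = F₃[[π]] : formal power series in the uniformizer π = T + i,
-- represented by their coefficient sequences.

A𝔭 : Set
A𝔭 = ℕ → F₃

infix 4 _≈_
_≈_ : A𝔭 → A𝔭 → Set
f ≈ g = ∀ n → f n ≡ g n

infixl 6 _+_ _-_
infixl 7 _*_

_+_ : A𝔭 → A𝔭 → A𝔭
(f + g) n = f n +F g n

_-_ : A𝔭 → A𝔭 → A𝔭
(f - g) n = f n -F g n

sumTo : ℕ → (ℕ → F₃) → F₃
sumTo zero h = h zero
sumTo (suc n) h = sumTo n h +F h (suc n)

_*_ : A𝔭 → A𝔭 → A𝔭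
(f * g) n = sumTo n (λ k → f k *F g (n ∸ k))

0A 1A : A𝔭
0A n = 0F
1A zero = 1F
1A (suc n) = 0F

IsUnit : A𝔭 → Set
IsUnit a = Σ A𝔭 λ b → a * b ≈ 1A

record M₂ : Set where
  constructor mat
  field
    a b c d : A𝔭
open M₂ public

infix 4 _≈M_
_≈M_ : M₂ → M₂ → Set
g ≈M h = (a g ≈ a h) × (b g ≈ b h) × (c g ≈ c h) × (d g ≈ d h)

infixl 7 _*M_
_*M_ : M₂ → M₂ → M₂
g *M h = mat (a g * a h + b g * c h) (a g * b h + b g * d h)
             (c g * a h + d g * c h) (c g * b h + d g * d h)

IM : M₂
IM = mat 1A 0A 0A 1A

det : M₂ → A𝔭
det g = a g * d g - b g * c g

InGL₂ : M₂ → Set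
InGL₂ g = IsUnit (det g)

CongMod : ℕ → M₂ → M₂ → Set
CongMod n g h = ∀ k → k < n →
  (a g k ≡ a h k) × (b g k ≡ b h k) × (c g k ≡ c h k) × (d g k ≡ d h k)

record IsSubgroup (H : M₂ → Set) : Set where
  field
    resp    : ∀ {g h} → g ≈M h → H g → H h
    ⊆GL₂    : ∀ {g} → H g → InGL₂ g
    one     : H IM
    mul     : ∀ {g h} → H g → H h → H (g *M h)
    inv     : ∀ {g} → H g → Σ M₂ λ h → H h × (g *M h ≈M IM) × (h *M g ≈M IM)

IsClosed : (M₂ → Set) → Set
IsClosed H = ∀ g → (∀ n → Σ M₂ λ h → H h × CongMod n h g) → H g

record M₂F : Set where
  constructor matF
  field
    a₀ b₀ c₀ d₀ : F₃
open M₂F public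

detF : M₂F → F₃
detF m = a₀ m *F d₀ m -F b₀ m *F c₀ m

InGL₂F₃ : M₂F → Set
InGL₂F₃ m = ¬ (detF m ≡ 0F)

-- coefficient of π^k of all entries; k = 0 is reduction mod 𝔭
coeffM : ℕ → M₂ → M₂F
coeffM k g = matF (a g k) (b g k) (c g k) (d g k)

IsScalarF : M₂F → Set
IsScalarF m = (b₀ m ≡ 0F) × (c₀ m ≡ 0F) × (a₀ m ≡ d₀ m)

IdF : M₂F
IdF = matF 1F 0F 0F 1F

-- det(H) = A_𝔭^*   (det(H) ⊆ A_𝔭^* is automatic for H ⊆ GL₂)
DetSurj : (M₂ → Set) → Set
DetSurj H = ∀ u → IsUnit u → Σ M₂ λ h → H h × (det h ≈ u)

-- H^[0] = GL₂(F₃): the reduction of H mod 𝔭 is all of GL₂(F₃)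
-- (the reduction always lands in GL₂(F₃))
H0Full : (M₂ → Set) → Set
H0Full H = ∀ m → InGL₂F₃ m → Σ M₂ λ h → H h × (coeffM 0 h ≡ m)

-- H^[1] contains a non-scalar matrix: some h = 1 + π y ∈ H with
-- y mod 𝔭 (= coefficient of π in h) non-scalar
H1NonScalar : (M₂ → Set) → Set
H1NonScalar H = Σ M₂ λ h → H h × (coeffM 0 h ≡ IdF) × ¬ IsScalarF (coeffM 1 h)

-- Successive approximation: for g ∈ GL₂(A𝔭) we find c ∈ H with det c = det g and c ≡ g mod π^n for
-- every n, and closedness puts g in H.  Since det(H) = A𝔭^*, it suffices that H ∩ SL₂ surjects onto each
-- layer of SL₂(A𝔭): onto SL₂(F₃) because every element of it is a commutator in GL₂(F₃); onto the trace-zero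
-- matrices sl₂(F₃) at level 1 because commutators [h, 1 + πY] = 1 + π(xYx⁻¹ - Y) (x = h mod π) turn the
-- non-scalar element of H^[1] into a non-zero element of sl₂(F₃), and the level-1 layer of H ∩ SL₂ is an
-- additive, GL₂(F₃)-stable subset of the irreducible module sl₂(F₃); at level n + 1 because
-- [1 + π^n X, 1 + π Y] ≡ 1 + π^(n+1) (XY - YX) and every element of sl₂(F₃) is a bracket.

module Submission where

open import Data.Nat as ℕ using (ℕ; zero; suc; _∸_; _<_; _≤_; z≤n; s≤s)
import Data.Nat.Properties as ℕ
open import Data.Fin.Properties using (_≟_; all?; any?)
open import Data.Product using (Σ; _×_; _,_; proj₁; proj₂)
open import Data.Sum using (inj₁; inj₂)
open import Data.Maybe using (Maybe; just; nothing)
open import Function using (_∘_)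
open import Level using (0ℓ)
open import Relation.Binary.PropositionalEquality
open import Relation.Nullary using (¬_; Dec; yes; no)
open import Relation.Nullary.Decidable using (from-yes; map′; _×-dec_; _→-dec_; ¬?)
open import Algebra.Bundles using (RawRing; CommutativeRing; Ring)
import Algebra.Solver.Ring
import Algebra.Solver.Ring.AlmostCommutativeRing as ACR

module Commutators {c ℓ} (R : Ring c ℓ) where
  private module R = Ring R
  open Ring R hiding (refl; sym; trans; setoid)
  open import Relation.Binary.Reasoning.Setoid R.setoid
  open import Algebra.Properties.Ring R using ([y-z]x≈yx-zx)
  open import Algebra.Properties.AbelianGroup +-abelianGroup using (⁻¹-∙-comm)
  open import Algebra.Properties.CommutativeSemigroup +-commutativeSemigroup using (interchange; x∙yz≈y∙xz)

  [x+y]-[x+z]≈y-z : ∀ x y z → (x + y) - (x + z) ≈ y - z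
  [x+y]-[x+z]≈y-z x y z = begin
    (x + y) - (x + z)        ≈⟨ +-congˡ (⁻¹-∙-comm x z) ⟨
    (x + y) + (- x + - z)    ≈⟨ interchange x y (- x) (- z) ⟩
    (x - x) + (y - z)        ≈⟨ +-congʳ (-‿inverseʳ x) ⟩
    0# + (y - z)             ≈⟨ +-identityˡ (y - z) ⟩
    y - z                    ∎

  x+y≈[x+z]+[y-z] : ∀ x y z → x + y ≈ (x + z) + (y - z)
  x+y≈[x+z]+[y-z] x y z = R.sym (begin
    (x + z) + (y - z)        ≈⟨ +-assoc x z (y - z) ⟩
    x + (z + (y - z))        ≈⟨ +-congˡ (x∙yz≈y∙xz z y (- z)) ⟩
    x + (y + (z - z))        ≈⟨ +-congˡ (+-congˡ (-‿inverseʳ z)) ⟩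
    x + (y + 0#)             ≈⟨ +-congˡ (+-identityʳ y) ⟩
    x + y                    ∎)

  [1+x]*y≈y+x*y : ∀ x y → (1# + x) * y ≈ y + x * y
  [1+x]*y≈y+x*y x y = R.trans (distribʳ y 1# x) (+-congʳ (*-identityˡ y))

  x*[1+y]≈x+x*y : ∀ x y → x * (1# + y) ≈ x + x * y
  x*[1+y]≈x+x*y x y = R.trans (distribˡ x 1# y) (+-congʳ (*-identityʳ x))

  [1+x]*[1+y] : ∀ x y → (1# + x) * (1# + y) ≈ 1# + ((x + y) + x * y)
  [1+x]*[1+y] x y = begin
    (1# + x) * (1# + y)          ≈⟨ [1+x]*y≈y+x*y x (1# + y) ⟩
    (1# + y) + x * (1# + y)      ≈⟨ +-congˡ (x*[1+y]≈x+x*y x y) ⟩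
    (1# + y) + (x + x * y)       ≈⟨ +-assoc 1# y (x + x * y) ⟩
    1# + (y + (x + x * y))       ≈⟨ +-congˡ (+-assoc y x (x * y)) ⟨
    1# + ((y + x) + x * y)       ≈⟨ +-congˡ (+-congʳ (+-comm y x)) ⟩
    1# + ((x + y) + x * y)       ∎

  commutator-with-1+ : ∀ x y → (1# + x) * y - y * (1# + x) ≈ x * y - y * x
  commutator-with-1+ x y = begin
    (1# + x) * y - y * (1# + x)    ≈⟨ +-cong ([1+x]*y≈y+x*y x y) (-‿cong (x*[1+y]≈x+x*y y x)) ⟩
    (y + x * y) - (y + y * x)      ≈⟨ [x+y]-[x+z]≈y-z y (x * y) (y * x) ⟩
    x * y - y * x                  ∎

  commutator-expansion : ∀ {h₁ h₁' h₂ h₂' s} → h₁ * h₁' ≈ 1# → h₂ * h₂' ≈ 1# → h₂ ≈ 1# + s →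
    ((h₁ * h₂) * h₁') * h₂' ≈ 1# + (h₁ * s - s * h₁) * (h₁' * h₂')
  commutator-expansion {h₁} {h₁'} {h₂} {h₂'} {s} e₁ e₂ eₛ = begin
    ((h₁ * h₂) * h₁') * h₂'                   ≈⟨ *-assoc (h₁ * h₂) h₁' h₂' ⟩
    (h₁ * h₂) * P                             ≈⟨ *-congʳ (*-congˡ eₛ) ⟩
    (h₁ * (1# + s)) * P                       ≈⟨ *-congʳ (x*[1+y]≈x+x*y h₁ s) ⟩
    (h₁ + h₁ * s) * P                         ≈⟨ distribʳ P h₁ (h₁ * s) ⟩
    h₁ * P + (h₁ * s) * P                     ≈⟨ x+y≈[x+z]+[y-z] (h₁ * P) ((h₁ * s) * P) ((s * h₁) * P) ⟩
    (h₁ * P + (s * h₁) * P) + ((h₁ * s) * P - (s * h₁) * P)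
                                              ≈⟨ +-cong one ([y-z]x≈yx-zx P (h₁ * s) (s * h₁)) ⟨
    1# + (h₁ * s - s * h₁) * P                ∎
    where
    P = h₁' * h₂'
    -- only right inverses are needed: (h₂ h₁) (h₁' h₂') = h₂ h₂' = 1
    one : 1# ≈ h₁ * P + (s * h₁) * P
    one = R.sym (begin
      h₁ * P + (s * h₁) * P     ≈⟨ distribʳ P h₁ (s * h₁) ⟨
      (h₁ + s * h₁) * P         ≈⟨ *-congʳ ([1+x]*y≈y+x*y s h₁) ⟨
      ((1# + s) * h₁) * P       ≈⟨ *-congʳ (*-congʳ eₛ) ⟨
      (h₂ * h₁) * P             ≈⟨ *-assoc h₂ h₁ P ⟩
      h₂ * (h₁ * P)             ≈⟨ *-congˡ (*-assoc h₁ h₁' h₂') ⟨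
      h₂ * ((h₁ * h₁') * h₂')   ≈⟨ *-congˡ (R.trans (*-congʳ e₁) (*-identityˡ h₂')) ⟩
      h₂ * h₂'                  ≈⟨ e₂ ⟩
      1#                        ∎)

open import Defs

-- Facts about F₃ and M₂(F₃) are proved by exhaustive check and kept opaque, so that the
-- type checker never unfolds the decision procedures behind them.
opaque
  +F-assoc : ∀ x y z → (x +F y) +F z ≡ x +F (y +F z)
  +F-assoc = from-yes (all? λ x → all? λ y → all? λ z → (x +F y) +F z ≟ x +F (y +F z))

  +F-comm : ∀ x y → x +F y ≡ y +F x
  +F-comm = from-yes (all? λ x → all? λ y → x +F y ≟ y +F x)

  +F-identityʳ : ∀ x → x +F 0F ≡ x
  +F-identityʳ = from-yes (all? λ x → x +F 0F ≟ x)

  +F-inverseˡ : ∀ x → negF x +F x ≡ 0F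
  +F-inverseˡ = from-yes (all? λ x → negF x +F x ≟ 0F)

  +F-inverseʳ : ∀ x → x +F negF x ≡ 0F
  +F-inverseʳ = from-yes (all? λ x → x +F negF x ≟ 0F)

  +F-interchange : ∀ w x y z → (w +F x) +F (y +F z) ≡ (w +F y) +F (x +F z)
  +F-interchange = from-yes (all? λ w → all? λ x → all? λ y → all? λ z →
    (w +F x) +F (y +F z) ≟ (w +F y) +F (x +F z))

  x≡y+[x-y] : ∀ x y → x ≡ y +F (x -F y)
  x≡y+[x-y] = from-yes (all? λ x → all? λ y → x ≟ y +F (x -F y))

  *F-assoc : ∀ x y z → (x *F y) *F z ≡ x *F (y *F z)
  *F-assoc = from-yes (all? λ x → all? λ y → all? λ z → (x *F y) *F z ≟ x *F (y *F z))

  *F-comm : ∀ x y → x *F y ≡ y *F x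
  *F-comm = from-yes (all? λ x → all? λ y → x *F y ≟ y *F x)

  *F-zeroʳ : ∀ x → x *F 0F ≡ 0F
  *F-zeroʳ = from-yes (all? λ x → x *F 0F ≟ 0F)

  *F-distribˡ : ∀ x y z → x *F (y +F z) ≡ x *F y +F x *F z
  *F-distribˡ = from-yes (all? λ x → all? λ y → all? λ z → x *F (y +F z) ≟ x *F y +F x *F z)

F₃-rawRing : RawRing 0ℓ 0ℓ
F₃-rawRing = record
  { Carrier = F₃ ; _≈_ = _≡_ ; _+_ = _+F_ ; _*_ = _*F_ ; -_ = negF ; 0# = 0F ; 1# = 1F }

infixl 7 _*MF_
infixl 6 _+MF_ _-MF_
infix 4 _≟MF_

_*MF_ : M₂F → M₂F → M₂F
x *MF y = matF (a₀ x *F a₀ y +F b₀ x *F c₀ y) (a₀ x *F b₀ y +F b₀ x *F d₀ y)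
               (c₀ x *F a₀ y +F d₀ x *F c₀ y) (c₀ x *F b₀ y +F d₀ x *F d₀ y)

_+MF_ : M₂F → M₂F → M₂F
x +MF y = matF (a₀ x +F a₀ y) (b₀ x +F b₀ y) (c₀ x +F c₀ y) (d₀ x +F d₀ y)

_-MF_ : M₂F → M₂F → M₂F
x -MF y = matF (a₀ x -F a₀ y) (b₀ x -F b₀ y) (c₀ x -F c₀ y) (d₀ x -F d₀ y)

0MF : M₂F
0MF = matF 0F 0F 0F 0F

traceF : M₂F → F₃
traceF x = a₀ x +F d₀ x

-- The adjugate scaled by the determinant, which is ±1 on GL₂(F₃) and so its own inverse.
invF : M₂F → M₂F
invF x = matF (detF x *F d₀ x) (detF x *F negF (b₀ x)) (detF x *F negF (c₀ x)) (detF x *F a₀ x)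

conjF : M₂F → M₂F → M₂F
conjF x y = (x *MF y) *MF invF x

hF : M₂F
hF = matF 1F 0F 0F 2F

matF-cong : ∀ {x₁ x₂ x₃ x₄ y₁ y₂ y₃ y₄} → x₁ ≡ y₁ → x₂ ≡ y₂ → x₃ ≡ y₃ → x₄ ≡ y₄ →
  matF x₁ x₂ x₃ x₄ ≡ matF y₁ y₂ y₃ y₄
matF-cong refl refl refl refl = refl

_≟MF_ : (x y : M₂F) → Dec (x ≡ y)
matF x₁ x₂ x₃ x₄ ≟MF matF y₁ y₂ y₃ y₄ =
  map′ (λ (e₁ , e₂ , e₃ , e₄) → matF-cong e₁ e₂ e₃ e₄) (λ { refl → refl , refl , refl , refl })
    (x₁ ≟ y₁ ×-dec x₂ ≟ y₂ ×-dec x₃ ≟ y₃ ×-dec x₄ ≟ y₄)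

∀MF? : {P : M₂F → Set} → (∀ x → Dec (P x)) → Dec (∀ x → P x)
∀MF? P? = map′ (λ p x → p (a₀ x) (b₀ x) (c₀ x) (d₀ x)) (λ p x₁ x₂ x₃ x₄ → p (matF x₁ x₂ x₃ x₄))
  (all? λ x₁ → all? λ x₂ → all? λ x₃ → all? λ x₄ → P? (matF x₁ x₂ x₃ x₄))

∃MF? : {P : M₂F → Set} → (∀ x → Dec (P x)) → Dec (Σ M₂F P)
∃MF? P? = map′ (λ (x₁ , x₂ , x₃ , x₄ , p) → matF x₁ x₂ x₃ x₄ , p) (λ (x , p) → a₀ x , b₀ x , c₀ x , d₀ x , p)
  (any? λ x₁ → any? λ x₂ → any? λ x₃ → any? λ x₄ → P? (matF x₁ x₂ x₃ x₄))

GL? : ∀ x → Dec (InGL₂F₃ x)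
GL? x = ¬? (detF x ≟ 0F)

SumOfTwoConjugates : M₂F → M₂F → Set
SumOfTwoConjugates w t = Σ M₂F λ x → Σ M₂F λ x' → InGL₂F₃ x × InGL₂F₃ x' × t ≡ conjF x w +MF conjF x' w

sumOfTwoConjugates? : ∀ w t → Dec (SumOfTwoConjugates w t)
sumOfTwoConjugates? w t = ∃MF? λ x → ∃MF? λ x' → GL? x ×-dec GL? x' ×-dec (t ≟MF conjF x w +MF conjF x' w)

opaque
  *MF-identityʳ : ∀ x → x *MF IdF ≡ x
  *MF-identityʳ = from-yes (∀MF? λ x → x *MF IdF ≟MF x)

  +MF-identityʳ : ∀ x → x +MF 0MF ≡ x
  +MF-identityʳ = from-yes (∀MF? λ x → x +MF 0MF ≟MF x)

  *MF-zeroʳ : ∀ x → x *MF 0MF ≡ 0MF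
  *MF-zeroʳ = from-yes (∀MF? λ x → x *MF 0MF ≟MF 0MF)

  -MF-+MF-cancel : ∀ x y → (x -MF y) +MF y ≡ x
  -MF-+MF-cancel = from-yes (∀MF? λ x → ∀MF? λ y → (x -MF y) +MF y ≟MF x)

  invF-unique : ∀ x x' → x *MF x' ≡ IdF → x' ≡ invF x
  invF-unique = from-yes (∀MF? λ x → ∀MF? λ x' → (x *MF x' ≟MF IdF) →-dec (x' ≟MF invF x))

  commutator-conj : ∀ x z → InGL₂F₃ x → (x *MF z -MF z *MF x) *MF invF x ≡ conjF x z -MF z
  commutator-conj = from-yes (∀MF? λ x → ∀MF? λ z → GL? x →-dec
    ((x *MF z -MF z *MF x) *MF invF x ≟MF conjF x z -MF z))

  traceF-conj-sub : ∀ x z → InGL₂F₃ x → traceF (conjF x z -MF z) ≡ 0F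
  traceF-conj-sub = from-yes (∀MF? λ x → ∀MF? λ z → GL? x →-dec (traceF (conjF x z -MF z) ≟ 0F))

  SL₂-commutator : ∀ m → detF m ≡ 1F →
    Σ M₂F λ x → Σ M₂F λ y → InGL₂F₃ x × InGL₂F₃ y × m ≡ ((x *MF y) *MF invF x) *MF invF y
  SL₂-commutator = from-yes (∀MF? λ m → (detF m ≟ 1F) →-dec ∃MF? λ x → ∃MF? λ y →
    GL? x ×-dec GL? y ×-dec (m ≟MF ((x *MF y) *MF invF x) *MF invF y))

  sl₂-bracket : ∀ z → traceF z ≡ 0F →
    Σ M₂F λ x → Σ M₂F λ y → traceF x ≡ 0F × traceF y ≡ 0F × z ≡ x *MF y -MF y *MF x
  sl₂-bracket = from-yes (∀MF? λ z → (traceF z ≟ 0F) →-dec ∃MF? λ x → ∃MF? λ y →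
    traceF x ≟ 0F ×-dec traceF y ≟ 0F ×-dec (z ≟MF x *MF y -MF y *MF x))

  nonscalar-conj-sub : ∀ y → ¬ IsScalarF y → Σ M₂F λ x → InGL₂F₃ x × ¬ conjF x y -MF y ≡ 0MF
  nonscalar-conj-sub = from-yes (∀MF? λ y → ¬? (b₀ y ≟ 0F ×-dec c₀ y ≟ 0F ×-dec a₀ y ≟ d₀ y) →-dec
    ∃MF? λ x → GL? x ×-dec ¬? (conjF x y -MF y ≟MF 0MF))

  hF-sumOfTwoConjugates : ∀ w → traceF w ≡ 0F → ¬ w ≡ 0MF → SumOfTwoConjugates w hF
  hF-sumOfTwoConjugates = from-yes (∀MF? λ w → (traceF w ≟ 0F) →-dec
    (¬? (w ≟MF 0MF) →-dec sumOfTwoConjugates? w hF))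

  sumOfTwoConjugates-hF : ∀ t → traceF t ≡ 0F → SumOfTwoConjugates hF t
  sumOfTwoConjugates-hF = from-yes (∀MF? λ t → (traceF t ≟ 0F) →-dec sumOfTwoConjugates? hF t)

-- Going through hF is needed: for elliptic w no nilpotent matrix is a sum of two conjugates of w.
sl₂-irreducible : (P : M₂F → Set) → (∀ {z w} → P z → P w → P (z +MF w)) →
  (∀ {x z} → InGL₂F₃ x → P z → P (conjF x z)) →
  ∀ {w} → traceF w ≡ 0F → ¬ w ≡ 0MF → P w → ∀ t → traceF t ≡ 0F → P t
sl₂-irreducible P P-+ P-conj trw≡0 w≢0 Pw t trt≡0 =
  spread (sumOfTwoConjugates-hF t trt≡0) (spread (hF-sumOfTwoConjugates _ trw≡0 w≢0) Pw)
  where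
  spread : ∀ {w t} → SumOfTwoConjugates w t → P w → P t
  spread (x , x' , x∈GL , x'∈GL , refl) Pw = P-+ (P-conj {x} x∈GL Pw) (P-conj {x'} x'∈GL Pw)

sumTo-cong : ∀ n {h h'} → (∀ k → k ≤ n → h k ≡ h' k) → sumTo n h ≡ sumTo n h'
sumTo-cong zero    e = e zero z≤n
sumTo-cong (suc n) e = cong₂ _+F_ (sumTo-cong n (λ k k≤n → e k (ℕ.m≤n⇒m≤1+n k≤n))) (e (suc n) ℕ.≤-refl)

sumTo-zero : ∀ n {h} → (∀ k → k ≤ n → h k ≡ 0F) → sumTo n h ≡ 0F
sumTo-zero n e = trans (sumTo-cong n e) (sumTo-const n)
  where
  sumTo-const : ∀ n → sumTo n (λ _ → 0F) ≡ 0F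
  sumTo-const zero    = refl
  sumTo-const (suc n) = cong (_+F 0F) (sumTo-const n)

sumTo-+ : ∀ n h h' → sumTo n (λ k → h k +F h' k) ≡ sumTo n h +F sumTo n h'
sumTo-+ zero    h h' = refl
sumTo-+ (suc n) h h' =
  trans (cong (_+F (h (suc n) +F h' (suc n))) (sumTo-+ n h h'))
        (+F-interchange (sumTo n h) (sumTo n h') (h (suc n)) (h' (suc n)))

*F-distribˡ-sumTo : ∀ n c h → c *F sumTo n h ≡ sumTo n (λ k → c *F h k)
*F-distribˡ-sumTo zero    c h = refl
*F-distribˡ-sumTo (suc n) c h =
  trans (*F-distribˡ c (sumTo n h) _) (cong (_+F c *F h (suc n)) (*F-distribˡ-sumTo n c h))

*F-distribʳ-sumTo : ∀ n c h → sumTo n h *F c ≡ sumTo n (λ k → h k *F c)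
*F-distribʳ-sumTo n c h =
  trans (*F-comm (sumTo n h) c)
        (trans (*F-distribˡ-sumTo n c h) (sumTo-cong n (λ k _ → *F-comm c (h k))))

sumTo-suc : ∀ n h → sumTo (suc n) h ≡ h zero +F sumTo n (h ∘ suc)
sumTo-suc zero    h = refl
sumTo-suc (suc n) h = trans (cong (_+F h (suc (suc n))) (sumTo-suc n h)) (+F-assoc (h zero) _ _)

sumTo-reverse : ∀ n h → sumTo n h ≡ sumTo n (λ k → h (n ∸ k))
sumTo-reverse zero    h = refl
sumTo-reverse (suc n) h = begin
  sumTo n h +F h (suc n)                    ≡⟨ +F-comm (sumTo n h) _ ⟩
  h (suc n) +F sumTo n h                    ≡⟨ cong (h (suc n) +F_) (sumTo-reverse n h) ⟩
  h (suc n) +F sumTo n (λ k → h (n ∸ k))    ≡⟨ sumTo-suc n (λ k → h (suc n ∸ k)) ⟨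
  sumTo (suc n) (λ k → h (suc n ∸ k))       ∎
  where open ≡-Reasoning

-- Fubini over the triangle j ≤ k ≤ n, with k = j + i.
sumTo-triangle : ∀ n (Φ : ℕ → ℕ → F₃) →
  sumTo n (λ k → sumTo k (Φ k)) ≡ sumTo n (λ j → sumTo (n ∸ j) (λ i → Φ (j ℕ.+ i) j))
sumTo-triangle zero    Φ = refl
sumTo-triangle (suc n) Φ = begin
  sumTo (suc n) (λ k → sumTo k (Φ k))
    ≡⟨ sumTo-cong (suc n) (λ k _ → split k) ⟩
  sumTo (suc n) (λ k → Φ k zero +F rest k)
    ≡⟨ sumTo-+ (suc n) _ rest ⟩
  sumTo (suc n) (λ k → Φ k zero) +F sumTo (suc n) rest
    ≡⟨ cong (sumTo (suc n) (λ k → Φ k zero) +F_) (sumTo-suc n rest) ⟩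
  sumTo (suc n) (λ k → Φ k zero) +F sumTo n (λ k → sumTo k (λ j → Φ (suc k) (suc j)))
    ≡⟨ cong (sumTo (suc n) (λ k → Φ k zero) +F_) (sumTo-triangle n (λ k j → Φ (suc k) (suc j))) ⟩
  sumTo (suc n) (λ k → Φ k zero) +F sumTo n (λ j → sumTo (n ∸ j) (λ i → Φ (suc (j ℕ.+ i)) (suc j)))
    ≡⟨ sumTo-suc n (λ j → sumTo (suc n ∸ j) (λ i → Φ (j ℕ.+ i) j)) ⟨
  sumTo (suc n) (λ j → sumTo (suc n ∸ j) (λ i → Φ (j ℕ.+ i) j)) ∎
  where
  open ≡-Reasoning
  rest : ℕ → F₃
  rest zero    = 0F
  rest (suc k) = sumTo k (λ j → Φ (suc k) (suc j))
  split : ∀ k → sumTo k (Φ k) ≡ Φ k zero +F rest k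
  split zero    = sym (+F-identityʳ _)
  split (suc k) = sumTo-suc k (Φ (suc k))

negA : A𝔭 → A𝔭
negA f n = negF (f n)

≈-refl : ∀ {f} → f ≈ f
≈-refl n = refl

≈-sym : ∀ {f g} → f ≈ g → g ≈ f
≈-sym e n = sym (e n)

≈-trans : ∀ {f g h} → f ≈ g → g ≈ h → f ≈ h
≈-trans e e' n = trans (e n) (e' n)

+-cong : ∀ {f f' g g'} → f ≈ f' → g ≈ g' → f + g ≈ f' + g'
+-cong e e' n = cong₂ _+F_ (e n) (e' n)

*-cong : ∀ {f f' g g'} → f ≈ f' → g ≈ g' → f * g ≈ f' * g'
*-cong e e' n = sumTo-cong n (λ k _ → cong₂ _*F_ (e k) (e' (n ∸ k)))

*-comm : ∀ f g → f * g ≈ g * f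
*-comm f g n = begin
  sumTo n (λ k → f k *F g (n ∸ k))              ≡⟨ sumTo-reverse n _ ⟩
  sumTo n (λ k → f (n ∸ k) *F g (n ∸ (n ∸ k)))  ≡⟨ sumTo-cong n swap ⟩
  sumTo n (λ k → g k *F f (n ∸ k))              ∎
  where
  open ≡-Reasoning
  swap : ∀ k → k ≤ n → f (n ∸ k) *F g (n ∸ (n ∸ k)) ≡ g k *F f (n ∸ k)
  swap k k≤n = trans (cong (λ i → f (n ∸ k) *F g i) (ℕ.m∸[m∸n]≡n k≤n)) (*F-comm (f (n ∸ k)) (g k))

*-assoc : ∀ f g h → (f * g) * h ≈ f * (g * h)
*-assoc f g h n = begin
  sumTo n (λ k → sumTo k (λ j → f j *F g (k ∸ j)) *F h (n ∸ k))
    ≡⟨ sumTo-cong n (λ k _ → *F-distribʳ-sumTo k (h (n ∸ k)) _) ⟩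
  sumTo n (λ k → sumTo k (λ j → (f j *F g (k ∸ j)) *F h (n ∸ k)))
    ≡⟨ sumTo-triangle n (λ k j → (f j *F g (k ∸ j)) *F h (n ∸ k)) ⟩
  sumTo n (λ j → sumTo (n ∸ j) (λ i → (f j *F g ((j ℕ.+ i) ∸ j)) *F h (n ∸ (j ℕ.+ i))))
    ≡⟨ sumTo-cong n (λ j _ → sumTo-cong (n ∸ j) (λ i _ → reindex j i)) ⟩
  sumTo n (λ j → sumTo (n ∸ j) (λ i → f j *F (g i *F h ((n ∸ j) ∸ i))))
    ≡⟨ sumTo-cong n (λ j _ → *F-distribˡ-sumTo (n ∸ j) (f j) _) ⟨
  sumTo n (λ j → f j *F sumTo (n ∸ j) (λ i → g i *F h ((n ∸ j) ∸ i))) ∎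
  where
  open ≡-Reasoning
  reindex : ∀ j i → (f j *F g ((j ℕ.+ i) ∸ j)) *F h (n ∸ (j ℕ.+ i)) ≡ f j *F (g i *F h ((n ∸ j) ∸ i))
  reindex j i = trans (cong₂ (λ u v → (f j *F g u) *F h v) (ℕ.m+n∸m≡n j i) (sym (ℕ.∸-+-assoc n j i)))
                      (*F-assoc (f j) _ _)

*-identityˡ : ∀ f → 1A * f ≈ f
*-identityˡ f zero    = refl
*-identityˡ f (suc n) =
  trans (sumTo-suc n _) (trans (cong (f (suc n) +F_) (sumTo-zero n (λ _ _ → refl))) (+F-identityʳ _))

*-distribˡ-+ : ∀ f g h → f * (g + h) ≈ f * g + f * h
*-distribˡ-+ f g h n = trans (sumTo-cong n (λ k _ → *F-distribˡ (f k) _ _)) (sumTo-+ n _ _)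

A𝔭-commutativeRing : CommutativeRing 0ℓ 0ℓ
A𝔭-commutativeRing = record
  { Carrier = A𝔭 ; _≈_ = _≈_ ; _+_ = _+_ ; _*_ = _*_ ; -_ = negA ; 0# = 0A ; 1# = 1A
  ; isCommutativeRing = record
    { isRing = record
      { +-isAbelianGroup = record
        { isGroup = record
          { isMonoid = record
            { isSemigroup = record
              { isMagma = record
                { isEquivalence = record { refl = ≈-refl ; sym = ≈-sym ; trans = ≈-trans }
                ; ∙-cong = +-cong }
              ; assoc = λ f g h n → +F-assoc (f n) (g n) (h n) }
            ; identity = (λ f n → refl) , (λ f n → +F-identityʳ (f n)) }
          ; inverse = (λ f n → +F-inverseˡ (f n)) , (λ f n → +F-inverseʳ (f n))
          ; ⁻¹-cong = λ e n → cong negF (e n) }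
        ; comm = λ f g n → +F-comm (f n) (g n) }
      ; *-cong = *-cong
      ; *-assoc = *-assoc
      ; *-identity = *-identityˡ , (λ f → ≈-trans (*-comm f 1A) (*-identityˡ f))
      ; distrib = *-distribˡ-+
                , (λ f g h → ≈-trans (*-comm (g + h) f)
                               (≈-trans (*-distribˡ-+ f g h) (+-cong (*-comm f g) (*-comm f h)))) }
    ; *-comm = *-comm } }

open CommutativeRing A𝔭-commutativeRing using (*-identityʳ)

const : F₃ → A𝔭
const c zero    = c
const c (suc n) = 0F

const-morphism : F₃-rawRing ACR.-Raw-AlmostCommutative⟶ ACR.fromCommutativeRing A𝔭-commutativeRing
const-morphism = record
  { ⟦_⟧    = const
  ; +-homo = λ { c d zero → refl ; c d (suc n) → refl }
  ; *-homo = *-homo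
  ; -‿homo = λ { c zero → refl ; c (suc n) → refl }
  ; 0-homo = λ { zero → refl ; (suc n) → refl }
  ; 1-homo = λ { zero → refl ; (suc n) → refl } }
  where
  *-homo : ∀ c d → const (c *F d) ≈ const c * const d
  *-homo c d zero    = refl
  *-homo c d (suc n) =
    sym (trans (sumTo-suc n _) (cong₂ _+F_ (*F-zeroʳ c) (sumTo-zero n (λ _ _ → refl))))

const-≟ : ∀ c d → Maybe (const c ≈ const d)
const-≟ c d with c ≟ d
... | yes refl = just ≈-refl
... | no _     = nothing

module A𝔭-Solver = Algebra.Solver.Ring F₃-rawRing
  (ACR.fromCommutativeRing A𝔭-commutativeRing) const-morphism const-≟

-- Multiplication by π^m, and its inverse on series divisible by π^m

shift : ℕ → A𝔭 → A𝔭
shift zero    f k       = f k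
shift (suc m) f zero    = 0F
shift (suc m) f (suc k) = shift m f k

drop : ℕ → A𝔭 → A𝔭
drop m f k = f (m ℕ.+ k)

shift-cong : ∀ m {f g} → f ≈ g → shift m f ≈ shift m g
shift-cong zero    e k       = e k
shift-cong (suc m) e zero    = refl
shift-cong (suc m) e (suc k) = shift-cong m e k

shift-+ : ∀ m f g → shift m (f + g) ≈ shift m f + shift m g
shift-+ zero    f g k       = refl
shift-+ (suc m) f g zero    = refl
shift-+ (suc m) f g (suc k) = shift-+ m f g k

shift-neg : ∀ m f → shift m (negA f) ≈ negA (shift m f)
shift-neg zero    f k       = refl
shift-neg (suc m) f zero    = refl
shift-neg (suc m) f (suc k) = shift-neg m f k

shift-*ˡ : ∀ m f g → shift m f * g ≈ shift m (f * g)
shift-*ˡ zero    f g k       = refl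
shift-*ˡ (suc m) f g zero    = refl
shift-*ˡ (suc m) f g (suc k) = trans (sumTo-suc k _) (shift-*ˡ m f g k)

shift-*ʳ : ∀ m f g → f * shift m g ≈ shift m (f * g)
shift-*ʳ m f g = ≈-trans (*-comm f (shift m g)) (≈-trans (shift-*ˡ m g f) (shift-cong m (*-comm g f)))

shift-shift : ∀ m n f → shift m (shift n f) ≈ shift (m ℕ.+ n) f
shift-shift zero    n f k       = refl
shift-shift (suc m) n f zero    = refl
shift-shift (suc m) n f (suc k) = shift-shift m n f k

shift-below : ∀ m f {k} → k < m → shift m f k ≡ 0F
shift-below (suc m) f {zero}  _         = refl
shift-below (suc m) f {suc k} (s≤s k<m) = shift-below m f k<m

shift-at : ∀ m f → shift m f m ≡ f zero
shift-at zero    f = refl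
shift-at (suc m) f = shift-at m f

shift-drop : ∀ m f → (∀ k → k < m → f k ≡ 0F) → f ≈ shift m (drop m f)
shift-drop zero    f e k       = refl
shift-drop (suc m) f e zero    = e zero (s≤s z≤n)
shift-drop (suc m) f e (suc k) = shift-drop m (f ∘ suc) (λ j j<m → e (suc j) (s≤s j<m)) k

infixl 6 _+M_ _-M_

_+M_ : M₂ → M₂ → M₂
g +M h = mat (a g + a h) (b g + b h) (c g + c h) (d g + d h)

negM : M₂ → M₂
negM g = mat (negA (a g)) (negA (b g)) (negA (c g)) (negA (d g))

_-M_ : M₂ → M₂ → M₂
g -M h = g +M negM h

0M : M₂
0M = mat 0A 0A 0A 0A

shiftM : ℕ → M₂ → M₂
shiftM m g = mat (shift m (a g)) (shift m (b g)) (shift m (c g)) (shift m (d g))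

dropM : ℕ → M₂ → M₂
dropM m g = mat (drop m (a g)) (drop m (b g)) (drop m (c g)) (drop m (d g))

module _ where
  open CommutativeRing A𝔭-commutativeRing
    using (+-assoc; +-comm; +-identityˡ; +-identityʳ; -‿inverseˡ; -‿inverseʳ; -‿cong; zeroˡ)
  open A𝔭-Solver using (solve; _:+_; _:*_; _:=_)

  private
    dot-assoc : ∀ x₁ x₂ y₁₁ y₁₂ y₂₁ y₂₂ z₁ z₂ →
      (x₁ * y₁₁ + x₂ * y₂₁) * z₁ + (x₁ * y₁₂ + x₂ * y₂₂) * z₂
        ≈ x₁ * (y₁₁ * z₁ + y₁₂ * z₂) + x₂ * (y₂₁ * z₁ + y₂₂ * z₂)
    dot-assoc = solve 8 (λ x₁ x₂ y₁₁ y₁₂ y₂₁ y₂₂ z₁ z₂ →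
      (x₁ :* y₁₁ :+ x₂ :* y₂₁) :* z₁ :+ (x₁ :* y₁₂ :+ x₂ :* y₂₂) :* z₂
        := x₁ :* (y₁₁ :* z₁ :+ y₁₂ :* z₂) :+ x₂ :* (y₂₁ :* z₁ :+ y₂₂ :* z₂)) ≈-refl

    dot-distribˡ : ∀ x₁ x₂ p₁ p₂ q₁ q₂ →
      x₁ * (p₁ + q₁) + x₂ * (p₂ + q₂) ≈ (x₁ * p₁ + x₂ * p₂) + (x₁ * q₁ + x₂ * q₂)
    dot-distribˡ = solve 6 (λ x₁ x₂ p₁ p₂ q₁ q₂ →
      x₁ :* (p₁ :+ q₁) :+ x₂ :* (p₂ :+ q₂) := (x₁ :* p₁ :+ x₂ :* p₂) :+ (x₁ :* q₁ :+ x₂ :* q₂)) ≈-refl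

    dot-distribʳ : ∀ x₁ x₂ p₁ p₂ q₁ q₂ →
      (p₁ + q₁) * x₁ + (p₂ + q₂) * x₂ ≈ (p₁ * x₁ + p₂ * x₂) + (q₁ * x₁ + q₂ * x₂)
    dot-distribʳ = solve 6 (λ x₁ x₂ p₁ p₂ q₁ q₂ →
      (p₁ :+ q₁) :* x₁ :+ (p₂ :+ q₂) :* x₂ := (p₁ :* x₁ :+ p₂ :* x₂) :+ (q₁ :* x₁ :+ q₂ :* x₂)) ≈-refl

    dot-unitˡ : ∀ x y → 1A * x + 0A * y ≈ x
    dot-unitˡ x y = ≈-trans (+-cong (*-identityˡ x) (zeroˡ y)) (+-identityʳ x)

    dot-unitʳ : ∀ x y → 0A * x + 1A * y ≈ y
    dot-unitʳ x y = ≈-trans (+-cong (zeroˡ x) (*-identityˡ y)) (+-identityˡ y)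

  *M-cong : ∀ {g g' h h'} → g ≈M g' → h ≈M h' → g *M h ≈M g' *M h'
  *M-cong (e₁ , e₂ , e₃ , e₄) (f₁ , f₂ , f₃ , f₄) =
    +-cong (*-cong e₁ f₁) (*-cong e₂ f₃) , +-cong (*-cong e₁ f₂) (*-cong e₂ f₄) ,
    +-cong (*-cong e₃ f₁) (*-cong e₄ f₃) , +-cong (*-cong e₃ f₂) (*-cong e₄ f₄)

  M₂-ring : Ring 0ℓ 0ℓ
  M₂-ring = record
    { Carrier = M₂ ; _≈_ = _≈M_ ; _+_ = _+M_ ; _*_ = _*M_ ; -_ = negM ; 0# = 0M ; 1# = IM
    ; isRing = record
      { +-isAbelianGroup = record
        { isGroup = record
          { isMonoid = record
            { isSemigroup = record
              { isMagma = record
                { isEquivalence = record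
                  { refl  = ≈-refl , ≈-refl , ≈-refl , ≈-refl
                  ; sym   = λ (e₁ , e₂ , e₃ , e₄) → ≈-sym e₁ , ≈-sym e₂ , ≈-sym e₃ , ≈-sym e₄
                  ; trans = λ (e₁ , e₂ , e₃ , e₄) (f₁ , f₂ , f₃ , f₄) →
                      ≈-trans e₁ f₁ , ≈-trans e₂ f₂ , ≈-trans e₃ f₃ , ≈-trans e₄ f₄ }
                ; ∙-cong = λ (e₁ , e₂ , e₃ , e₄) (f₁ , f₂ , f₃ , f₄) →
                    +-cong e₁ f₁ , +-cong e₂ f₂ , +-cong e₃ f₃ , +-cong e₄ f₄ }
              ; assoc = λ g h k → +-assoc (a g) (a h) (a k) , +-assoc (b g) (b h) (b k) ,
                                  +-assoc (c g) (c h) (c k) , +-assoc (d g) (d h) (d k) }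
            ; identity = (λ g → +-identityˡ (a g) , +-identityˡ (b g) , +-identityˡ (c g) , +-identityˡ (d g))
                       , (λ g → +-identityʳ (a g) , +-identityʳ (b g) , +-identityʳ (c g) , +-identityʳ (d g)) }
          ; inverse = (λ g → -‿inverseˡ (a g) , -‿inverseˡ (b g) , -‿inverseˡ (c g) , -‿inverseˡ (d g))
                    , (λ g → -‿inverseʳ (a g) , -‿inverseʳ (b g) , -‿inverseʳ (c g) , -‿inverseʳ (d g))
          ; ⁻¹-cong = λ (e₁ , e₂ , e₃ , e₄) → -‿cong e₁ , -‿cong e₂ , -‿cong e₃ , -‿cong e₄ }
        ; comm = λ g h → +-comm (a g) (a h) , +-comm (b g) (b h) , +-comm (c g) (c h) , +-comm (d g) (d h) }
      ; *-cong = *M-cong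
      ; *-assoc = λ g h k →
          dot-assoc (a g) (b g) (a h) (b h) (c h) (d h) (a k) (c k) ,
          dot-assoc (a g) (b g) (a h) (b h) (c h) (d h) (b k) (d k) ,
          dot-assoc (c g) (d g) (a h) (b h) (c h) (d h) (a k) (c k) ,
          dot-assoc (c g) (d g) (a h) (b h) (c h) (d h) (b k) (d k)
      ; *-identity =
          (λ g → dot-unitˡ (a g) (c g) , dot-unitˡ (b g) (d g) , dot-unitʳ (a g) (c g) , dot-unitʳ (b g) (d g))
        , (λ g → ≈-trans (+-cong (*-comm (a g) 1A) (*-comm (b g) 0A)) (dot-unitˡ (a g) (b g)) ,
                 ≈-trans (+-cong (*-comm (a g) 0A) (*-comm (b g) 1A)) (dot-unitʳ (a g) (b g)) ,
                 ≈-trans (+-cong (*-comm (c g) 1A) (*-comm (d g) 0A)) (dot-unitˡ (c g) (d g)) ,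
                 ≈-trans (+-cong (*-comm (c g) 0A) (*-comm (d g) 1A)) (dot-unitʳ (c g) (d g)))
      ; distrib =
          (λ g h k →
            dot-distribˡ (a g) (b g) (a h) (c h) (a k) (c k) , dot-distribˡ (a g) (b g) (b h) (d h) (b k) (d k) ,
            dot-distribˡ (c g) (d g) (a h) (c h) (a k) (c k) , dot-distribˡ (c g) (d g) (b h) (d h) (b k) (d k))
        , (λ g h k →
            dot-distribʳ (a g) (c g) (a h) (b h) (a k) (b k) , dot-distribʳ (b g) (d g) (a h) (b h) (a k) (b k) ,
            dot-distribʳ (a g) (c g) (c h) (d h) (c k) (d k) , dot-distribʳ (b g) (d g) (c h) (d h) (c k) (d k)) } }

open Ring M₂-ring using () renaming (setoid to M₂-setoid; refl to ≈M-refl; sym to ≈M-sym; trans to ≈M-trans)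
open Commutators M₂-ring

module _ where
  open CommutativeRing A𝔭-commutativeRing using (-‿cong)
  open A𝔭-Solver using (solve; _:+_; _:*_; _:-_; _:=_)

  det-cong : ∀ {g h} → g ≈M h → det g ≈ det h
  det-cong (e₁ , e₂ , e₃ , e₄) = +-cong (*-cong e₁ e₄) (-‿cong (*-cong e₂ e₃))

  det-* : ∀ g h → det (g *M h) ≈ det g * det h
  det-* g h = lemma (a g) (b g) (c g) (d g) (a h) (b h) (c h) (d h)
    where
    lemma : ∀ a b c d e f g h →
      (a * e + b * g) * (c * f + d * h) - (a * f + b * h) * (c * e + d * g) ≈ (a * d - b * c) * (e * h - f * g)
    lemma = solve 8 (λ a b c d e f g h →
      (a :* e :+ b :* g) :* (c :* f :+ d :* h) :- (a :* f :+ b :* h) :* (c :* e :+ d :* g)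
        := (a :* d :- b :* c) :* (e :* h :- f :* g)) ≈-refl

  det-IM : det IM ≈ 1A
  det-IM = ≈-trans (+-cong (*-identityˡ 1A) (-‿cong (CommutativeRing.zeroˡ A𝔭-commutativeRing 0A)))
                   (CommutativeRing.+-identityʳ A𝔭-commutativeRing 1A)

  det-inverse : ∀ {g g'} → g *M g' ≈M IM → det g * det g' ≈ 1A
  det-inverse {g} {g'} e = ≈-trans (≈-sym (det-* g g')) (≈-trans (det-cong e) det-IM)

  det-commutator : ∀ {g g' h h'} → g *M g' ≈M IM → h *M h' ≈M IM → det (((g *M h) *M g') *M h') ≈ 1A
  det-commutator {g} {g'} {h} {h'} e₁ e₂ =
    ≈-trans (det-* ((g *M h) *M g') h')
   (≈-trans (*-cong (≈-trans (det-* (g *M h) g') (*-cong (det-* g h) (≈-refl {det g'}))) (≈-refl {det h'}))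
   (≈-trans (regroup (det g) (det h) (det g') (det h'))
   (≈-trans (*-cong (det-inverse {g} {g'} e₁) (det-inverse {h} {h'} e₂)) (*-identityˡ 1A))))
    where
    regroup : ∀ p q r s → ((p * q) * r) * s ≈ (p * r) * (q * s)
    regroup = solve 4 (λ p q r s → ((p :* q) :* r) :* s := (p :* r) :* (q :* s)) ≈-refl

shiftM-cong : ∀ m {g h} → g ≈M h → shiftM m g ≈M shiftM m h
shiftM-cong m (e₁ , e₂ , e₃ , e₄) = shift-cong m e₁ , shift-cong m e₂ , shift-cong m e₃ , shift-cong m e₄

shiftM-*ˡ : ∀ m g h → shiftM m g *M h ≈M shiftM m (g *M h)
shiftM-*ˡ m g h = dot (a g) (a h) (b g) (c h) , dot (a g) (b h) (b g) (d h) ,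
                  dot (c g) (a h) (d g) (c h) , dot (c g) (b h) (d g) (d h)
  where
  dot : ∀ p q r s → shift m p * q + shift m r * s ≈ shift m (p * q + r * s)
  dot p q r s = ≈-trans (+-cong (shift-*ˡ m p q) (shift-*ˡ m r s)) (≈-sym (shift-+ m _ _))

shiftM-*ʳ : ∀ m g h → g *M shiftM m h ≈M shiftM m (g *M h)
shiftM-*ʳ m g h = dot (a g) (a h) (b g) (c h) , dot (a g) (b h) (b g) (d h) ,
                  dot (c g) (a h) (d g) (c h) , dot (c g) (b h) (d g) (d h)
  where
  dot : ∀ p q r s → p * shift m q + r * shift m s ≈ shift m (p * q + r * s)
  dot p q r s = ≈-trans (+-cong (shift-*ʳ m p q) (shift-*ʳ m r s)) (≈-sym (shift-+ m _ _))

shiftM-+ : ∀ m g h → shiftM m (g +M h) ≈M shiftM m g +M shiftM m h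
shiftM-+ m g h = shift-+ m _ _ , shift-+ m _ _ , shift-+ m _ _ , shift-+ m _ _

shiftM-- : ∀ m g h → shiftM m (g -M h) ≈M shiftM m g -M shiftM m h
shiftM-- m g h = ≈M-trans (shiftM-+ m g (negM h)) (+-congˡ {shiftM m g}
  (shift-neg m (a h) , shift-neg m (b h) , shift-neg m (c h) , shift-neg m (d h)))
  where open Ring M₂-ring using (+-congˡ)

shiftM-shiftM : ∀ m n g → shiftM m (shiftM n g) ≈M shiftM (m ℕ.+ n) g
shiftM-shiftM m n g = shift-shift m n _ , shift-shift m n _ , shift-shift m n _ , shift-shift m n _

coeffM-cong : ∀ k {g h} → g ≈M h → coeffM k g ≡ coeffM k h
coeffM-cong k (e₁ , e₂ , e₃ , e₄) = matF-cong (e₁ k) (e₂ k) (e₃ k) (e₄ k)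

≈M⇒CongMod : ∀ n {g h} → g ≈M h → CongMod n g h
≈M⇒CongMod n (e₁ , e₂ , e₃ , e₄) k _ = e₁ k , e₂ k , e₃ k , e₄ k

CongMod-sym : ∀ {n g h} → CongMod n g h → CongMod n h g
CongMod-sym e k k<n = let (e₁ , e₂ , e₃ , e₄) = e k k<n in sym e₁ , sym e₂ , sym e₃ , sym e₄

CongMod-trans : ∀ {n g h i} → CongMod n g h → CongMod n h i → CongMod n g i
CongMod-trans e f k k<n =
  let (e₁ , e₂ , e₃ , e₄) = e k k<n ; (f₁ , f₂ , f₃ , f₄) = f k k<n
  in trans e₁ f₁ , trans e₂ f₂ , trans e₃ f₃ , trans e₄ f₄

CongMod-suc : ∀ {n g h} → CongMod n g h → coeffM n g ≡ coeffM n h → CongMod (suc n) g h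
CongMod-suc e top k k<1+n with ℕ.m<1+n⇒m<n∨m≡n k<1+n
... | inj₁ k<n  = e k k<n
... | inj₂ refl = cong a₀ top , cong b₀ top , cong c₀ top , cong d₀ top

AgreeBelow : ℕ → A𝔭 → A𝔭 → Set
AgreeBelow n f g = ∀ k → k < n → f k ≡ g k

*-agreeBelow : ∀ {n f f' g g'} → AgreeBelow n f f' → AgreeBelow n g g' → AgreeBelow n (f * g) (f' * g')
*-agreeBelow ef eg k k<n = sumTo-cong k (λ j j≤k →
  cong₂ _*F_ (ef j (ℕ.≤-<-trans j≤k k<n)) (eg (k ∸ j) (ℕ.≤-<-trans (ℕ.m∸n≤m k j) k<n)))

CongMod-* : ∀ {n g g' h h'} → CongMod n g g' → CongMod n h h' → CongMod n (g *M h) (g' *M h')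
CongMod-* {n} e f k k<n =
  dot (aᵉ e) (aᵉ f) (bᵉ e) (cᵉ f) , dot (aᵉ e) (bᵉ f) (bᵉ e) (dᵉ f) ,
  dot (cᵉ e) (aᵉ f) (dᵉ e) (cᵉ f) , dot (cᵉ e) (bᵉ f) (dᵉ e) (dᵉ f)
  where
  dot : ∀ {p p' q q' r r' s s'} → AgreeBelow n p p' → AgreeBelow n q q' →
    AgreeBelow n r r' → AgreeBelow n s s' → (p * q + r * s) k ≡ (p' * q' + r' * s') k
  dot ep eq er es = cong₂ _+F_ (*-agreeBelow ep eq k k<n) (*-agreeBelow er es k k<n)
  aᵉ : ∀ {g g'} → CongMod n g g' → AgreeBelow n (a g) (a g')
  bᵉ : ∀ {g g'} → CongMod n g g' → AgreeBelow n (b g) (b g')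
  cᵉ : ∀ {g g'} → CongMod n g g' → AgreeBelow n (c g) (c g')
  dᵉ : ∀ {g g'} → CongMod n g g' → AgreeBelow n (d g) (d g')
  aᵉ e j j<n = proj₁ (e j j<n)
  bᵉ e j j<n = proj₁ (proj₂ (e j j<n))
  cᵉ e j j<n = proj₁ (proj₂ (proj₂ (e j j<n)))
  dᵉ e j j<n = proj₂ (proj₂ (proj₂ (e j j<n)))

1+shiftM-drop : ∀ m {h} → CongMod m h IM → h ≈M IM +M shiftM m (dropM m (h -M IM))
1+shiftM-drop m {h} e =
  split (a h) 1A (λ k k<m → proj₁ (e k k<m)) ,
  split (b h) 0A (λ k k<m → proj₁ (proj₂ (e k k<m))) ,
  split (c h) 0A (λ k k<m → proj₁ (proj₂ (proj₂ (e k k<m)))) ,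
  split (d h) 1A (λ k k<m → proj₂ (proj₂ (proj₂ (e k k<m))))
  where
  split : ∀ f i → AgreeBelow m f i → f ≈ i + shift m (drop m (f - i))
  split f i f≡i k = trans (x≡y+[x-y] (f k) (i k))
    (cong (i k +F_) (shift-drop m (f - i) (λ j j<m → trans (cong (_-F i j) (f≡i j j<m)) (+F-inverseʳ (i j))) k))

coeffM-drop : ∀ m h → coeffM 0 (dropM (suc m) (h -M IM)) ≡ coeffM (suc m) h
coeffM-drop m h rewrite ℕ.+-identityʳ m =
  matF-cong (+F-identityʳ (a h (suc m))) (+F-identityʳ (b h (suc m)))
            (+F-identityʳ (c h (suc m))) (+F-identityʳ (d h (suc m)))

CongMod-1+shiftM : ∀ m Q → CongMod m (IM +M shiftM m Q) IM
CongMod-1+shiftM m Q k k<m = below (1A k) (a Q) , below 0F (b Q) , below 0F (c Q) , below (1A k) (d Q)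
  where
  below : ∀ x q → x +F shift m q k ≡ x
  below x q = trans (cong (x +F_) (shift-below m q k<m)) (+F-identityʳ x)

coeffM-1+shiftM : ∀ m Q → coeffM (suc m) (IM +M shiftM (suc m) Q) ≡ coeffM 0 Q
coeffM-1+shiftM m Q =
  matF-cong (shift-at m (a Q)) (shift-at m (b Q)) (shift-at m (c Q)) (shift-at m (d Q))

module _ where
  open Ring M₂-ring using () renaming (+-congˡ to +M-congˡ; +-cong to +M-cong; -‿cong to negM-cong)
  open import Relation.Binary.Reasoning.Setoid M₂-setoid

  1+-cong : ∀ {X Y} → X ≈M Y → IM +M X ≈M IM +M Y
  1+-cong = +M-congˡ {IM}

  commutator-1+shiftM : ∀ m {h₁ h₁' h₂ h₂' Y} → h₁ *M h₁' ≈M IM → h₂ *M h₂' ≈M IM →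
    h₂ ≈M IM +M shiftM m Y →
    ((h₁ *M h₂) *M h₁') *M h₂' ≈M IM +M shiftM m ((h₁ *M Y -M Y *M h₁) *M (h₁' *M h₂'))
  commutator-1+shiftM m {h₁} {h₁'} {h₂} {h₂'} {Y} e₁ e₂ h₂≈ = begin
    ((h₁ *M h₂) *M h₁') *M h₂'                       ≈⟨ commutator-expansion {h₁} {h₁'} {h₂} {h₂'} {s} e₁ e₂ h₂≈ ⟩
    IM +M (h₁ *M s -M s *M h₁) *M P                  ≈⟨ 1+-cong (*M-cong shifted (≈M-refl {P})) ⟩
    IM +M shiftM m (h₁ *M Y -M Y *M h₁) *M P         ≈⟨ 1+-cong (shiftM-*ˡ m _ P) ⟩
    IM +M shiftM m ((h₁ *M Y -M Y *M h₁) *M P)       ∎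
    where
    s = shiftM m Y
    P = h₁' *M h₂'
    shifted : h₁ *M s -M s *M h₁ ≈M shiftM m (h₁ *M Y -M Y *M h₁)
    shifted = ≈M-trans (+M-cong (shiftM-*ʳ m h₁ Y) (negM-cong (shiftM-*ˡ m Y h₁))) (≈M-sym (shiftM-- m _ _))

  commutator-1+shiftM-1+shiftM : ∀ m n {h₁ h₁' h₂ h₂' X Y} → h₁ *M h₁' ≈M IM → h₂ *M h₂' ≈M IM →
    h₁ ≈M IM +M shiftM n X → h₂ ≈M IM +M shiftM m Y →
    ((h₁ *M h₂) *M h₁') *M h₂' ≈M IM +M shiftM (m ℕ.+ n) ((X *M Y -M Y *M X) *M (h₁' *M h₂'))
  commutator-1+shiftM-1+shiftM m n {h₁} {h₁'} {h₂} {h₂'} {X} {Y} e₁ e₂ h₁≈ h₂≈ = begin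
    ((h₁ *M h₂) *M h₁') *M h₂'                         ≈⟨ commutator-1+shiftM m {h₁} {h₁'} {h₂} {h₂'} {Y} e₁ e₂ h₂≈ ⟩
    IM +M shiftM m ((h₁ *M Y -M Y *M h₁) *M P)         ≈⟨ 1+-cong (shiftM-cong m (*M-cong lie (≈M-refl {P}))) ⟩
    IM +M shiftM m (shiftM n [X,Y] *M P)               ≈⟨ 1+-cong (shiftM-cong m (shiftM-*ˡ n [X,Y] P)) ⟩
    IM +M shiftM m (shiftM n ([X,Y] *M P))             ≈⟨ 1+-cong (shiftM-shiftM m n _) ⟩
    IM +M shiftM (m ℕ.+ n) ([X,Y] *M P)                ∎
    where
    P = h₁' *M h₂'
    [X,Y] = X *M Y -M Y *M X
    lie : h₁ *M Y -M Y *M h₁ ≈M shiftM n [X,Y]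
    lie = begin
      h₁ *M Y -M Y *M h₁
        ≈⟨ +M-cong (*M-cong h₁≈ (≈M-refl {Y})) (negM-cong (*M-cong (≈M-refl {Y}) h₁≈)) ⟩
      (IM +M shiftM n X) *M Y -M Y *M (IM +M shiftM n X)
        ≈⟨ commutator-with-1+ (shiftM n X) Y ⟩
      shiftM n X *M Y -M Y *M shiftM n X
        ≈⟨ +M-cong (shiftM-*ˡ n X Y) (negM-cong (shiftM-*ʳ n Y X)) ⟩
      shiftM n (X *M Y) -M shiftM n (Y *M X)
        ≈⟨ shiftM-- n _ _ ⟨
      shiftM n [X,Y] ∎

  1+shiftM-* : ∀ m X₁ X₂ →
    (IM +M shiftM m X₁) *M (IM +M shiftM m X₂) ≈M IM +M shiftM m ((X₁ +M X₂) +M X₁ *M shiftM m X₂)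
  1+shiftM-* m X₁ X₂ = begin
    (IM +M shiftM m X₁) *M (IM +M shiftM m X₂)
      ≈⟨ [1+x]*[1+y] (shiftM m X₁) (shiftM m X₂) ⟩
    IM +M ((shiftM m X₁ +M shiftM m X₂) +M shiftM m X₁ *M shiftM m X₂)
      ≈⟨ 1+-cong (+M-cong (≈M-sym (shiftM-+ m X₁ X₂)) (shiftM-*ˡ m X₁ (shiftM m X₂))) ⟩
    IM +M (shiftM m (X₁ +M X₂) +M shiftM m (X₁ *M shiftM m X₂))
      ≈⟨ 1+-cong (shiftM-+ m _ _) ⟨
    IM +M shiftM m ((X₁ +M X₂) +M X₁ *M shiftM m X₂) ∎

module _ where
  open CommutativeRing A𝔭-commutativeRing using (-‿cong)
  open A𝔭-Solver using (solve; _:+_; _:*_; _:-_; _:=_)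

  det-1+ : ∀ p q r s → (1A + p) * (1A + s) - q * r ≈ 1A + ((p + s) + (p * s - q * r))
  det-1+ p q r s = ≈-trans (expand 1A p q r s)
    (+-cong (*-identityˡ 1A) (+-cong (+-cong (*-identityˡ p) (*-identityˡ s)) ≈-refl))
    where
    expand : ∀ o p q r s → (o + p) * (o + s) - q * r ≈ o * o + ((o * p + o * s) + (p * s - q * r))
    expand = solve 5 (λ o p q r s →
      (o :+ p) :* (o :+ s) :- q :* r := o :* o :+ ((o :* p :+ o :* s) :+ (p :* s :- q :* r))) ≈-refl

-- det (1 + π^m Y) ≡ 1 + π^m tr Y (mod π^(m+1)) for m ≥ 1.
trace-leading : ∀ n {e} → det e ≈ 1A → CongMod (suc n) e IM → traceF (coeffM (suc n) e) ≡ 0F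
trace-leading n {e} det≈1 e≡1 = subst (λ z → traceF z ≡ 0F) (coeffM-drop n e) (sym (begin
  0F
    ≡⟨ expanded m ⟩
  (p m +F s m) +F ((p * s) m -F (q * r) m)
    ≡⟨ cong₂ _+F_ (cong₂ _+F_ (shift-at m (a Y)) (shift-at m (d Y)))
                  (cong₂ _-F_ (vanishes (a Y) (d Y)) (vanishes (b Y) (c Y))) ⟩
  (a Y 0 +F d Y 0) +F (0F -F 0F)
    ≡⟨ +F-identityʳ _ ⟩
  a Y 0 +F d Y 0 ∎))
  where
  open ≡-Reasoning
  m = suc n
  Y = dropM m (e -M IM)
  p = shift m (a Y)
  q = shift m (b Y)
  r = shift m (c Y)
  s = shift m (d Y)
  expanded : 1A ≈ 1A + ((p + s) + (p * s - q * r))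
  expanded = ≈-trans (≈-sym det≈1) (≈-trans (det-cong (1+shiftM-drop m e≡1)) (det-1+ p q r s))
  vanishes : ∀ f g → (shift m f * shift m g) m ≡ 0F
  vanishes f g = trans (shift-*ˡ m f (shift m g) m) (trans (shift-at m _) (*F-zeroʳ (f 0)))

reduction-inverse : ∀ {g g'} → g *M g' ≈M IM → coeffM 0 g' ≡ invF (coeffM 0 g)
reduction-inverse {g} {g'} e = invF-unique (coeffM 0 g) (coeffM 0 g') (coeffM-cong 0 e)

reduction≡1 : ∀ {m h} → CongMod (suc m) h IM → coeffM 0 h ≡ IdF
reduction≡1 h≡1 = let (e₁ , e₂ , e₃ , e₄) = h≡1 0 (s≤s z≤n) in matF-cong e₁ e₂ e₃ e₄

module Layers (H : M₂ → Set) (H-subgroup : IsSubgroup H) (H0 : H0Full H) where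
  open IsSubgroup H-subgroup

  -- z ∈ H^[n], witnessed in H (Layer) or in H ∩ SL₂ (SLayer)
  record Layer (n : ℕ) (z : M₂F) : Set where
    constructor layer
    field
      elt     : M₂
      elt∈H   : H elt
      elt≡1   : CongMod n elt IM
      leading : coeffM n elt ≡ z

  record SLayer (n : ℕ) (z : M₂F) : Set where
    constructor slayer
    field
      elt     : M₂
      elt∈H   : H elt
      det≈1   : det elt ≈ 1A
      elt≡1   : CongMod n elt IM
      leading : coeffM n elt ≡ z

  SLayer⇒Layer : ∀ {n z} → SLayer n z → Layer n z
  SLayer⇒Layer (slayer h h∈H _ h≡1 lead) = layer h h∈H h≡1 lead

  SLayer-from : ∀ m {h Q} → H h → det h ≈ 1A → h ≈M IM +M shiftM (suc m) Q → SLayer (suc m) (coeffM 0 Q)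
  SLayer-from m {h} {Q} h∈H det≈1 h≈ = slayer h h∈H det≈1
    (CongMod-trans (≈M⇒CongMod (suc m) h≈) (CongMod-1+shiftM (suc m) Q))
    (trans (coeffM-cong (suc m) h≈) (coeffM-1+shiftM m Q))

  leading-drop : ∀ m h {z} → coeffM (suc m) h ≡ z → coeffM 0 (dropM (suc m) (h -M IM)) ≡ z
  leading-drop m h = trans (coeffM-drop m h)

  commutator∈H : ∀ {h₁ h₁' h₂ h₂'} → H h₁ → H h₁' → H h₂ → H h₂' → H (((h₁ *M h₂) *M h₁') *M h₂')
  commutator∈H h₁∈H h₁'∈H h₂∈H h₂'∈H = mul (mul (mul h₁∈H h₂∈H) h₁'∈H) h₂'∈H

  conj-sub∈SLayer : ∀ m {h₁ z} → H h₁ → InGL₂F₃ (coeffM 0 h₁) → Layer (suc m) z →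
    SLayer (suc m) (conjF (coeffM 0 h₁) z -MF z)
  conj-sub∈SLayer m {h₁} {z} h₁∈H x∈GL (layer h₂ h₂∈H h₂≡1 lead) with inv h₁∈H | inv h₂∈H
  ... | h₁' , h₁'∈H , e₁ , _ | h₂' , h₂'∈H , e₂ , _ =
    subst (SLayer (suc m)) leading-coeff
      (SLayer-from m (commutator∈H h₁∈H h₁'∈H h₂∈H h₂'∈H) (det-commutator {h₁} {h₁'} {h₂} {h₂'} e₁ e₂)
        (commutator-1+shiftM (suc m) {h₁} {h₁'} {h₂} {h₂'} {Y} e₁ e₂ (1+shiftM-drop (suc m) h₂≡1)))
    where
    open ≡-Reasoning
    x = coeffM 0 h₁
    Y = dropM (suc m) (h₂ -M IM)
    leading-coeff : coeffM 0 ((h₁ *M Y -M Y *M h₁) *M (h₁' *M h₂')) ≡ conjF x z -MF z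
    leading-coeff = begin
      (x *MF coeffM 0 Y -MF coeffM 0 Y *MF x) *MF (coeffM 0 h₁' *MF coeffM 0 h₂')
        ≡⟨ cong₂ (λ y r → (x *MF y -MF y *MF x) *MF r) (leading-drop m h₂ lead)
                 (cong₂ _*MF_ (reduction-inverse {h₁} {h₁'} e₁)
                              (trans (reduction-inverse {h₂} {h₂'} e₂) (cong invF (reduction≡1 h₂≡1)))) ⟩
      (x *MF z -MF z *MF x) *MF (invF x *MF IdF)   ≡⟨ cong ((x *MF z -MF z *MF x) *MF_) (*MF-identityʳ (invF x)) ⟩
      (x *MF z -MF z *MF x) *MF invF x             ≡⟨ commutator-conj x z x∈GL ⟩
      conjF x z -MF z                              ∎

  bracket∈SLayer : ∀ m n {x y} → Layer (suc n) x → Layer (suc m) y →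
    SLayer (suc m ℕ.+ suc n) (x *MF y -MF y *MF x)
  bracket∈SLayer m n {x} {y} (layer h₁ h₁∈H h₁≡1 lead₁) (layer h₂ h₂∈H h₂≡1 lead₂) with inv h₁∈H | inv h₂∈H
  ... | h₁' , h₁'∈H , e₁ , _ | h₂' , h₂'∈H , e₂ , _ =
    subst (SLayer (suc m ℕ.+ suc n)) leading-coeff
      (SLayer-from (m ℕ.+ suc n) (commutator∈H h₁∈H h₁'∈H h₂∈H h₂'∈H) (det-commutator {h₁} {h₁'} {h₂} {h₂'} e₁ e₂)
        (commutator-1+shiftM-1+shiftM (suc m) (suc n) {h₁} {h₁'} {h₂} {h₂'} {X} {Y} e₁ e₂
          (1+shiftM-drop (suc n) h₁≡1) (1+shiftM-drop (suc m) h₂≡1)))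
    where
    open ≡-Reasoning
    X = dropM (suc n) (h₁ -M IM)
    Y = dropM (suc m) (h₂ -M IM)
    inverse≡1 : ∀ {k h h'} → CongMod (suc k) h IM → h *M h' ≈M IM → coeffM 0 h' ≡ IdF
    inverse≡1 {h = h} {h'} h≡1 e = trans (reduction-inverse {h} {h'} e) (cong invF (reduction≡1 h≡1))
    leading-coeff : coeffM 0 ((X *M Y -M Y *M X) *M (h₁' *M h₂')) ≡ x *MF y -MF y *MF x
    leading-coeff = begin
      (coeffM 0 X *MF coeffM 0 Y -MF coeffM 0 Y *MF coeffM 0 X) *MF (coeffM 0 h₁' *MF coeffM 0 h₂')
        ≡⟨ cong₂ (λ u r → u *MF r)
             (cong₂ (λ x' y' → x' *MF y' -MF y' *MF x') (leading-drop n h₁ lead₁) (leading-drop m h₂ lead₂))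
             (cong₂ _*MF_ (inverse≡1 {h = h₁} {h₁'} h₁≡1 e₁) (inverse≡1 {h = h₂} {h₂'} h₂≡1 e₂)) ⟩
      (x *MF y -MF y *MF x) *MF (IdF *MF IdF)
        ≡⟨ *MF-identityʳ (x *MF y -MF y *MF x) ⟩
      x *MF y -MF y *MF x ∎

  SLayer-+ : ∀ m {x y} → SLayer (suc m) x → SLayer (suc m) y → SLayer (suc m) (x +MF y)
  SLayer-+ m {x} {y} (slayer h₁ h₁∈H det₁ h₁≡1 lead₁) (slayer h₂ h₂∈H det₂ h₂≡1 lead₂) =
    subst (SLayer (suc m)) leading-coeff
      (SLayer-from m (mul h₁∈H h₂∈H) (≈-trans (det-* h₁ h₂) (≈-trans (*-cong det₁ det₂) (*-identityˡ 1A)))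
        (≈M-trans (*M-cong (1+shiftM-drop (suc m) h₁≡1) (1+shiftM-drop (suc m) h₂≡1)) (1+shiftM-* (suc m) X₁ X₂)))
    where
    open ≡-Reasoning
    X₁ = dropM (suc m) (h₁ -M IM)
    X₂ = dropM (suc m) (h₂ -M IM)
    leading-coeff : coeffM 0 ((X₁ +M X₂) +M X₁ *M shiftM (suc m) X₂) ≡ x +MF y
    leading-coeff = begin
      (coeffM 0 X₁ +MF coeffM 0 X₂) +MF coeffM 0 X₁ *MF 0MF
        ≡⟨ cong₂ (λ x' y' → (x' +MF y') +MF x' *MF 0MF) (leading-drop m h₁ lead₁) (leading-drop m h₂ lead₂) ⟩
      (x +MF y) +MF x *MF 0MF   ≡⟨ cong ((x +MF y) +MF_) (*MF-zeroʳ x) ⟩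
      (x +MF y) +MF 0MF         ≡⟨ +MF-identityʳ (x +MF y) ⟩
      x +MF y                   ∎

  SLayer-conj : ∀ m {h z} → H h → InGL₂F₃ (coeffM 0 h) → SLayer (suc m) z →
    SLayer (suc m) (conjF (coeffM 0 h) z)
  SLayer-conj m {h} {z} h∈H x∈GL z∈S =
    subst (SLayer (suc m)) (-MF-+MF-cancel (conjF (coeffM 0 h) z) z)
      (SLayer-+ m (conj-sub∈SLayer m h∈H x∈GL (SLayer⇒Layer z∈S)) z∈S)

  sl₂⊆SLayer : H1NonScalar H → ∀ n z → traceF z ≡ 0F → SLayer (suc n) z
  sl₂⊆SLayer (h , h∈H , h≡1 , y-nonscalar) zero with nonscalar-conj-sub (coeffM 1 h) y-nonscalar
  ... | x , x∈GL , moves =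
    sl₂-irreducible (SLayer 1) (SLayer-+ 0) (λ {x} → conj {x})
      (traceF-conj-sub x y x∈GL) moves (conj-sub-y {x} x∈GL)
    where
    y = coeffM 1 h
    conj : ∀ {x z} → InGL₂F₃ x → SLayer 1 z → SLayer 1 (conjF x z)
    conj {x} x∈GL z∈S with H0 x x∈GL
    ... | g , g∈H , refl = SLayer-conj 0 g∈H x∈GL z∈S
    conj-sub-y : ∀ {x} → InGL₂F₃ x → SLayer 1 (conjF x y -MF y)
    conj-sub-y {x} x∈GL with H0 x x∈GL
    ... | g , g∈H , refl = conj-sub∈SLayer 0 g∈H x∈GL (layer h h∈H (CongMod-suc (λ _ ()) h≡1) refl)
  sl₂⊆SLayer H1 (suc n) z trz≡0 with sl₂-bracket z trz≡0
  ... | x , y , trx≡0 , try≡0 , refl =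
    bracket∈SLayer 0 n (SLayer⇒Layer (sl₂⊆SLayer H1 n x trx≡0)) (SLayer⇒Layer (sl₂⊆SLayer H1 0 y try≡0))

  SL₂F₃⊆reduction : ∀ m → detF m ≡ 1F → Σ M₂ λ k → H k × det k ≈ 1A × coeffM 0 k ≡ m
  SL₂F₃⊆reduction m det≡1 with SL₂-commutator m det≡1
  ... | x , y , x∈GL , y∈GL , refl with H0 x x∈GL | H0 y y∈GL
  ... | h₁ , h₁∈H , refl | h₂ , h₂∈H , refl with inv h₁∈H | inv h₂∈H
  ... | h₁' , h₁'∈H , e₁ , _ | h₂' , h₂'∈H , e₂ , _ =
    ((h₁ *M h₂) *M h₁') *M h₂' , commutator∈H h₁∈H h₁'∈H h₂∈H h₂'∈H ,
    det-commutator {h₁} {h₁'} {h₂} {h₂'} e₁ e₂ ,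
    cong₂ (λ u v → ((x *MF y) *MF u) *MF v) (reduction-inverse {h₁} {h₁'} e₁) (reduction-inverse {h₂} {h₂'} e₂)

  approximate-SL : H1NonScalar H → ∀ n {e} → det e ≈ 1A → CongMod n e IM →
    Σ M₂ λ k → H k × det k ≈ 1A × CongMod (suc n) k e
  approximate-SL _ zero {e} det≈1 _ with SL₂F₃⊆reduction (coeffM 0 e) (det≈1 0)
  ... | k , k∈H , det-k , k≡e = k , k∈H , det-k , CongMod-suc (λ _ ()) k≡e
  approximate-SL H1 (suc n) {e} det≈1 e≡1 =
    lift (sl₂⊆SLayer H1 n (coeffM (suc n) e) (trace-leading n {e} det≈1 e≡1))
    where
    lift : SLayer (suc n) (coeffM (suc n) e) → Σ M₂ λ k → H k × det k ≈ 1A × CongMod (suc (suc n)) k e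
    lift (slayer k k∈H det-k k≡1 lead) = k , k∈H , det-k , CongMod-suc (CongMod-trans k≡1 (CongMod-sym e≡1)) lead

module Approximation (H : M₂ → Set) (H-subgroup : IsSubgroup H)
                     (surj : DetSurj H) (H0 : H0Full H) (H1 : H1NonScalar H) where
  open IsSubgroup H-subgroup
  open Layers H H-subgroup H0
  open Ring M₂-ring using () renaming (*-assoc to *M-assoc; *-identityˡ to *M-identityˡ)

  Approximant : ℕ → M₂ → Set
  Approximant n g = Σ M₂ λ c → H c × det c ≈ det g × CongMod n c g

  refine : ∀ n {g} → Approximant n g → Approximant (suc n) g
  refine n {g} (c , c∈H , det-c , c≡g) = correct (inv c∈H)
    where
    correct : Σ M₂ (λ c⁻¹ → H c⁻¹ × (c *M c⁻¹ ≈M IM) × (c⁻¹ *M c ≈M IM)) → Approximant (suc n) g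
    correct (c⁻¹ , c⁻¹∈H , cc⁻¹≈1 , c⁻¹c≈1) = correct-by (approximate-SL H1 n {c⁻¹ *M g} det≈1 e≡1)
      where
      det≈1 : det (c⁻¹ *M g) ≈ 1A
      det≈1 = ≈-trans (det-* c⁻¹ g)
             (≈-trans (*-cong (≈-refl {det c⁻¹}) (≈-sym det-c))
             (≈-trans (*-comm (det c⁻¹) (det c)) (det-inverse {c} {c⁻¹} cc⁻¹≈1)))
      e≡1 : CongMod n (c⁻¹ *M g) IM
      e≡1 = CongMod-trans (CongMod-* (≈M⇒CongMod n (≈M-refl {c⁻¹})) (CongMod-sym c≡g)) (≈M⇒CongMod n c⁻¹c≈1)
      cc⁻¹g≈g : c *M (c⁻¹ *M g) ≈M g
      cc⁻¹g≈g = ≈M-trans (≈M-sym (*M-assoc c c⁻¹ g)) (≈M-trans (*M-cong cc⁻¹≈1 (≈M-refl {g})) (*M-identityˡ g))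
      correct-by : Σ M₂ (λ k → H k × det k ≈ 1A × CongMod (suc n) k (c⁻¹ *M g)) → Approximant (suc n) g
      correct-by (k , k∈H , det-k , k≡e) =
        c *M k , mul c∈H k∈H ,
        ≈-trans (det-* c k) (≈-trans (*-cong (≈-refl {det c}) det-k) (≈-trans (*-identityʳ (det c)) det-c)) ,
        CongMod-trans (CongMod-* (≈M⇒CongMod (suc n) (≈M-refl {c})) k≡e) (≈M⇒CongMod (suc n) cc⁻¹g≈g)

  approximate : ∀ n g → InGL₂ g → Approximant n g
  approximate zero    g g∈GL = let (c , c∈H , det-c) = surj (det g) g∈GL in c , c∈H , det-c , λ _ ()
  approximate (suc n) g g∈GL = refine n (approximate n g g∈GL)

proposition5p6 : (H : M₂ → Set) → IsSubgroup H → IsClosed H →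
    DetSurj H → H0Full H → H1NonScalar H →
    ∀ g → InGL₂ g → H g
proposition5p6 H H-subgroup H-closed surj H0 H1 g g∈GL = H-closed g λ n →
  let (c , c∈H , _ , c≡g) = approximate n g g∈GL in c , c∈H , c≡g
  where open Approximation H H-subgroup surj H0 H1
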